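{- Let $A,O,E$ be non-empty sets each equipped with an equivalence relation, and let $\phi\subseteq A\times O\times E$. Then for all $X\subseteq A$, $Y\subseteq O$, $Z\subseteq E$: $\underline{\alpha}_E(\phi)(X,Y)=\underline{\alpha}_E(\underline{\phi})(X,Y)$, $\underline{\alpha}_O(\phi)(X,Z)=\underline{\alpha}_O(\underline{\phi})(X,Z)$, and $\underline{\alpha}_A(\phi)(Y,Z)=\underline{\alpha}_A(\underline{\phi})(Y,Z)$.
   Context: For an element $x$ of $A$ (resp. $O$, $E$), $[x]$ denotes its equivalence class. For a subset $X$ of one of these sets, $\underline{X}=\{z:[z]\subseteq X\}$. For a ternary relation $\psi\subseteq A\times O\times E$: $\underline{\psi}=\{\langle a,o,e\rangle:[a]\times[o]\times[e]\subseteq\psi\}$; and the lower approximation operators are $a\in\underline{\alpha}_A(\psi)(Y,Z)\iff[a]\times\underline{Y}\times\underline{Z}\subseteq\psi$, $o\in\underline{\alpha}_O(\psi)(X,Z)\iff\underline{X}\times[o]\times\underline{Z}\subseteq\psi$, $e\in\underline{\alpha}_E(\psi)(X,Y)\iff\underline{X}\times\underline{Y}\times[e]\subseteq\psi$. -}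

module Defs where

open import Level using (Level; _⊔_; suc)
open import Data.Product using (_×_; _,_; ∃)
open import Relation.Binary.Bundles using (Setoid)
open import Relation.Unary using (Pred; _⊆_)

_≐_ : ∀ {a ℓ ℓ'} {A : Set a} → Pred A ℓ → Pred A ℓ' → Set (a ⊔ ℓ ⊔ ℓ')
P ≐ Q = (P ⊆ Q) × (Q ⊆ P)

module Approx {c₁ c₂ c₃ ℓ₁ ℓ₂ ℓ₃ : Level}
  (SA : Setoid c₁ ℓ₁) (SO : Setoid c₂ ℓ₂) (SE : Setoid c₃ ℓ₃) where
  open Setoid SA renaming (Carrier to A; _≈_ to _≈A_)
  open Setoid SO renaming (Carrier to O; _≈_ to _≈O_)
  open Setoid SE renaming (Carrier to E; _≈_ to _≈E_)

  TRel : (ℓ : Level) → Set _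
  TRel ℓ = A → O → E → Set ℓ

  clsA : A → Pred A ℓ₁
  clsA a a' = a ≈A a'
  clsO : O → Pred O ℓ₂
  clsO o o' = o ≈O o'
  clsE : E → Pred E ℓ₃
  clsE e e' = e ≈E e'

  lowA : ∀ {ℓ} → Pred A ℓ → Pred A _
  lowA X z = clsA z ⊆ X
  lowO : ∀ {ℓ} → Pred O ℓ → Pred O _
  lowO Y z = clsO z ⊆ Y
  lowE : ∀ {ℓ} → Pred E ℓ → Pred E _
  lowE Z z = clsE z ⊆ Z

  lowR : ∀ {ℓ} → TRel ℓ → A → O → E → Set _
  lowR ψ a o e = ∀ {a' o' e'} → clsA a a' → clsO o o' → clsE e e' → ψ a' o' e'

  αA : ∀ {ℓ ℓy ℓz} → TRel ℓ → Pred O ℓy → Pred E ℓz → Pred A _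
  αA ψ Y Z a = ∀ {a' o e} → clsA a a' → lowO Y o → lowE Z e → ψ a' o e

  αO : ∀ {ℓ ℓx ℓz} → TRel ℓ → Pred A ℓx → Pred E ℓz → Pred O _
  αO ψ X Z o = ∀ {a o' e} → lowA X a → clsO o o' → lowE Z e → ψ a o' e

  αE : ∀ {ℓ ℓx ℓy} → TRel ℓ → Pred A ℓx → Pred O ℓy → Pred E _
  αE ψ X Y e = ∀ {a o e'} → lowA X a → lowO Y o → clsE e e' → ψ a o e'

module Submission where

-- A box [a]×low Y×low Z (and its variants) is a union of classes of the product
-- equivalence, since a lower approximation is closed under ≈. Such a box lies in φ
-- exactly when it lies in the largest union of classes inside φ, namely lowR φ.

open import Defs
open import Level using (Level)
open import Data.Product using (_×_; _,_)
open import Relation.Binary.Bundles using (Setoid)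
open import Relation.Unary using (Pred)

module LowerApproximationProperties {c₁ c₂ c₃ ℓ₁ ℓ₂ ℓ₃ : Level}
  (SA : Setoid c₁ ℓ₁) (SO : Setoid c₂ ℓ₂) (SE : Setoid c₃ ℓ₃) where
  open Approx SA SO SE
  open Setoid SA using () renaming (Carrier to A; _≈_ to _≈A_; refl to reflA; trans to transA)
  open Setoid SO using () renaming (Carrier to O; _≈_ to _≈O_; refl to reflO; trans to transO)
  open Setoid SE using () renaming (Carrier to E; _≈_ to _≈E_; refl to reflE; trans to transE)

  _⊆₃_ : ∀ {ℓ ℓ'} → TRel ℓ → TRel ℓ' → Set _
  ψ ⊆₃ ψ' = ∀ {a o e} → ψ a o e → ψ' a o e

  lowA-resp-≈ : ∀ {ℓ} {X : Pred A ℓ} {a a'} → lowA X a → a ≈A a' → lowA X a'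
  lowA-resp-≈ low a≈a' a'≈z = low (transA a≈a' a'≈z)

  lowO-resp-≈ : ∀ {ℓ} {Y : Pred O ℓ} {o o'} → lowO Y o → o ≈O o' → lowO Y o'
  lowO-resp-≈ low o≈o' o'≈z = low (transO o≈o' o'≈z)

  lowE-resp-≈ : ∀ {ℓ} {Z : Pred E ℓ} {e e'} → lowE Z e → e ≈E e' → lowE Z e'
  lowE-resp-≈ low e≈e' e'≈z = low (transE e≈e' e'≈z)

  lowR-⊆ : ∀ {ℓ} (ψ : TRel ℓ) → lowR ψ ⊆₃ ψ
  lowR-⊆ ψ h = h reflA reflO reflE

  module _ {ℓ ℓ' ℓx ℓy : Level} {X : Pred A ℓx} {Y : Pred O ℓy} where

    αE-mono : {ψ : TRel ℓ} {ψ' : TRel ℓ'} → ψ ⊆₃ ψ' → ∀ {e} → αE ψ X Y e → αE ψ' X Y e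
    αE-mono ψ⊆ψ' h lowX lowY e≈e' = ψ⊆ψ' (h lowX lowY e≈e')

  module _ {ℓ ℓx ℓy : Level} (ψ : TRel ℓ) {X : Pred A ℓx} {Y : Pred O ℓy} where

    αE-lowR : αE ψ X Y ≐ αE (lowR ψ) X Y
    αE-lowR = saturate , αE-mono (lowR-⊆ ψ)
      where
      saturate : ∀ {e} → αE ψ X Y e → αE (lowR ψ) X Y e
      saturate h lowX lowY e≈e' a≈a' o≈o' e'≈e'' =
        h (lowA-resp-≈ lowX a≈a') (lowO-resp-≈ lowY o≈o') (transE e≈e' e'≈e'')

  module _ {ℓ ℓ' ℓx ℓz : Level} {X : Pred A ℓx} {Z : Pred E ℓz} where

    αO-mono : {ψ : TRel ℓ} {ψ' : TRel ℓ'} → ψ ⊆₃ ψ' → ∀ {o} → αO ψ X Z o → αO ψ' X Z o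
    αO-mono ψ⊆ψ' h lowX o≈o' lowZ = ψ⊆ψ' (h lowX o≈o' lowZ)

  module _ {ℓ ℓx ℓz : Level} (ψ : TRel ℓ) {X : Pred A ℓx} {Z : Pred E ℓz} where

    αO-lowR : αO ψ X Z ≐ αO (lowR ψ) X Z
    αO-lowR = saturate , αO-mono (lowR-⊆ ψ)
      where
      saturate : ∀ {o} → αO ψ X Z o → αO (lowR ψ) X Z o
      saturate h lowX o≈o' lowZ a≈a' o'≈o'' e≈e' =
        h (lowA-resp-≈ lowX a≈a') (transO o≈o' o'≈o'') (lowE-resp-≈ lowZ e≈e')

  module _ {ℓ ℓ' ℓy ℓz : Level} {Y : Pred O ℓy} {Z : Pred E ℓz} where

    αA-mono : {ψ : TRel ℓ} {ψ' : TRel ℓ'} → ψ ⊆₃ ψ' → ∀ {a} → αA ψ Y Z a → αA ψ' Y Z a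
    αA-mono ψ⊆ψ' h a≈a' lowY lowZ = ψ⊆ψ' (h a≈a' lowY lowZ)

  module _ {ℓ ℓy ℓz : Level} (ψ : TRel ℓ) {Y : Pred O ℓy} {Z : Pred E ℓz} where

    αA-lowR : αA ψ Y Z ≐ αA (lowR ψ) Y Z
    αA-lowR = saturate , αA-mono (lowR-⊆ ψ)
      where
      saturate : ∀ {a} → αA ψ Y Z a → αA (lowR ψ) Y Z a
      saturate h a≈a' lowY lowZ a'≈a'' o≈o' e≈e' =
        h (transA a≈a' a'≈a'') (lowO-resp-≈ lowY o≈o') (lowE-resp-≈ lowZ e≈e')

mainTheorem7 : ∀ {c₁ c₂ c₃ ℓ₁ ℓ₂ ℓ₃ ℓ : Level}
    (SA : Setoid c₁ ℓ₁) (SO : Setoid c₂ ℓ₂) (SE : Setoid c₃ ℓ₃) →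
    Setoid.Carrier SA → Setoid.Carrier SO → Setoid.Carrier SE →
    (φ : Approx.TRel SA SO SE ℓ) →
    (X : Pred (Setoid.Carrier SA) ℓ) (Y : Pred (Setoid.Carrier SO) ℓ) (Z : Pred (Setoid.Carrier SE) ℓ) →
    (Approx.αE SA SO SE φ X Y ≐ Approx.αE SA SO SE (Approx.lowR SA SO SE φ) X Y)
    × (Approx.αO SA SO SE φ X Z ≐ Approx.αO SA SO SE (Approx.lowR SA SO SE φ) X Z)
    × (Approx.αA SA SO SE φ Y Z ≐ Approx.αA SA SO SE (Approx.lowR SA SO SE φ) Y Z)
mainTheorem7 SA SO SE _ _ _ φ X Y Z = αE-lowR φ , αO-lowR φ , αA-lowR φ
  where open LowerApproximationProperties SA SO SE
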